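{- Let $n \geq 1$, $m \geq 1$ and $k \geq 2$ be integers, let $G$ be an $n$-vertex graph, let $w$ and $w'$ be $m$-weightings of $G$, and let $I$ and $I'$ be independent sets of $G$ with $|I| \leq |I'|$, such that $w(v) = 0$ for each $v \in V(G) \setminus I$ and $w'$ is uniform on $I'$. Then $\pi_k(G(w')) \leq \pi_k(G(w))$.
   Context: All graphs are simple. $\mathbb{N}_0 = \{0,1,2,\dots\}$. For a graph $G$, a function $w: V(G) \to \mathbb{N}_0$ with $\sum_{v \in V(G)} w(v) = m$ is an $m$-weighting of $G$. $G(w)$ is the graph obtained from $G$ by replacing each vertex $v$ by a clique $K^v$ on $w(v)$ vertices and joining every vertex of $K^u$ to every vertex of $K^v$ whenever $uv \in E(G)$. $\pi_k(H)$ denotes the number of $k$-cliques of a graph $H$. An $m$-weighting $w$ is uniform on $U \subseteq V(G)$ if $w(v)=0$ for all $v \notin U$ and $w(u) \in \{\lfloor m/|U|\rfloor, \lceil m/|U| \rceil\}$ for all $u \in U$. -}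

module Defs where

open import Data.Nat using (ℕ; zero; suc; _+_; _∸_; _≡ᵇ_)
open import Data.Nat.DivMod using (_/_)
open import Data.Fin using (Fin; _≟_)
open import Data.Fin.Subset using (Subset; _∈_; _∉_; ∣_∣)
open import Data.Bool using (Bool; true; false; not; _∧_; T)
open import Data.Bool.Properties using (T?)
open import Data.List using (List; []; _∷_; map; concatMap; upTo; allFin; length; filter; _++_)
open import Data.Nat.ListAction using (sum)
open import Data.Product using (_×_; _,_; Σ)
open import Data.Sum using (_⊎_)
open import Data.Empty using (⊥)
open import Relation.Nullary using (does)
open import Relation.Binary.PropositionalEquality using (_≡_)

record Graph (n : ℕ) : Set where
  field
    adj    : Fin n → Fin n → Bool
    sym    : ∀ u v → adj u v ≡ adj v u
    irrefl : ∀ v → adj v v ≡ false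
open Graph public

IsWeighting : (n m : ℕ) → (Fin n → ℕ) → Set
IsWeighting n m w = sum (map w (allFin n)) ≡ m

Independent : ∀ {n} → Graph n → Subset n → Set
Independent G I = ∀ u v → u ∈ I → v ∈ I → adj G u v ≡ false

-- Ceiling division ⌈ m / s ⌉ for s = suc t.
ceilDiv : ℕ → ℕ → ℕ
ceilDiv m t = (m + t) / suc t

-- w is uniform on U (w is an m-weighting; m/|U| is meaningless for U = ∅,
-- so uniformity on the empty set is taken to be impossible).
UniformOn : ∀ {n} → (m : ℕ) → (Fin n → ℕ) → Subset n → Set
UniformOn {n} m w U with ∣ U ∣
... | zero  = ⊥
... | suc t = (∀ v → v ∉ U → w v ≡ 0) ×
              (∀ u → u ∈ U → (w u ≡ m / suc t) ⊎ (w u ≡ ceilDiv m t))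

-- The blow-up G(w): vertices are pairs (v , i) with i < w v (the clique K^v).
BVertex : ℕ → Set
BVertex n = Fin n × ℕ

blowVertices : ∀ {n} → (Fin n → ℕ) → List (BVertex n)
blowVertices {n} w = concatMap (λ v → map (λ i → (v , i)) (upTo (w v))) (allFin n)

blowAdj : ∀ {n} → Graph n → BVertex n → BVertex n → Bool
blowAdj G (u , i) (v , j) with does (u ≟ v)
... | true  = not (i ≡ᵇ j)
... | false = adj G u v

-- All k-element sublists of a list (k-subsets when the list has no duplicates).
choose : {A : Set} → ℕ → List A → List (List A)
choose zero    xs       = [] ∷ []
choose (suc k) []       = []
choose (suc k) (x ∷ xs) = map (x ∷_) (choose k xs) ++ choose (suc k) xs

allB : {A : Set} → (A → Bool) → List A → Bool
allB p []       = true
allB p (x ∷ xs) = p x ∧ allB p xs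

isClique : {A : Set} → (A → A → Bool) → List A → Bool
isClique a []       = true
isClique a (x ∷ xs) = allB (a x) xs ∧ isClique a xs

πk : ∀ {n} → ℕ → Graph n → (Fin n → ℕ) → ℕ
πk k G w = length (filter (λ S → T? (isClique (blowAdj G) S)) (choose k (blowVertices w)))

{-# OPTIONS --safe #-}
-- When the support of w is independent, a clique of G(w) lies inside a single
-- clique K^v, so π_k(G(w)) = Σ_v C(w(v), k).  The map x ↦ C(x, k) is convex on
-- ℕ, so it lies above its secant through q and q + 1, and on that secant
-- exactly at x ∈ {q, q + 1}.  Summing the secant bound over I and the secant
-- identity over I′ (q = ⌊m/|I′|⌋) reduces the claim to
-- (|I′| − |I|)·(C(q, k) − q·C(q, k − 1)) ≤ 0, which holds since
-- C(q, k) ≤ q·C(q, k − 1).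
module Submission where

open import Defs hiding (sym)
open import Data.Nat using (ℕ; zero; suc; _+_; _*_; _≤_; _≡ᵇ_; z≤n; s≤s)
open import Data.Nat.Properties
  using ( ≤-refl; ≤-reflexive; ≤-trans; ≤-antisym; m≤m+n; m≤n+m; n≤1+n; m≤n⇒m<n∨m≡n
        ; +-assoc; +-comm; +-identityʳ; +-mono-≤; +-monoˡ-≤; +-monoʳ-≤; +-cancelˡ-≤
        ; *-distribʳ-+; *-monoʳ-≤; ≡ᵇ⇒≡; m≤n⇒∃[o]m+o≡n; ≤-total; module ≤-Reasoning )
open import Data.Nat.DivMod using (_/_; /-monoˡ-≤; +-distrib-/-∣ʳ; n/n≡1)
open import Data.Nat.Divisibility using (∣-refl)
open import Data.Nat.Combinatorics using (_C_; nCk+nC[k+1]≡[n+1]C[k+1])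
open import Data.Nat.ListAction using (sum)
open import Data.Nat.Solver using (module +-*-Solver)
open import Data.Fin using (Fin; _≟_) renaming (zero to fzero; suc to fsuc)
open import Data.Fin.Subset using (Subset; _∈_; _∉_; ∣_∣)
open import Data.Fin.Subset.Properties using (_∈?_)
open import Data.Vec using (lookup) renaming ([] to []ᵥ; _∷_ to _∷ᵥ_)
open import Data.Vec.Properties using ([]=⇒lookup; lookup⇒[]=)
open import Data.Bool using (Bool; true; false; _∧_; T; if_then_else_)
open import Data.Bool.Properties using (T?; ∧-assoc; ∧-zeroʳ; ∧-commutativeMonoid)
open import Algebra.Bundles using (CommutativeMonoid)
open import Algebra.Properties.CommutativeSemigroup (CommutativeMonoid.commutativeSemigroup ∧-commutativeMonoid)
  using () renaming (interchange to ∧-interchange)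
open import Data.List using (List; []; _∷_; map; concat; upTo; allFin; length; filter; _++_)
open import Data.List.Properties using (length-map; length-upTo; map-∘; map-cong; map-tabulate)
open import Data.List.Relation.Unary.All as All using (All; []; _∷_)
open import Data.List.Relation.Unary.All.Properties as All using (All-swap)
open import Data.List.Relation.Unary.AllPairs as AllPairs using (AllPairs; []; _∷_)
open import Data.List.Relation.Unary.AllPairs.Properties as AllPairs using ()
open import Data.List.Relation.Unary.Unique.Propositional.Properties using (upTo⁺; allFin⁺)
open import Data.Product using (Σ; _×_; _,_; proj₁; proj₂)
open import Data.Sum using (_⊎_; inj₁; inj₂)
open import Data.Empty using (⊥-elim)
open import Data.Unit using (tt)
open import Function using (_∘_)
open import Relation.Nullary using (yes; no; ¬_)
open import Relation.Binary.PropositionalEquality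
  using (_≡_; refl; sym; trans; cong; cong₂; subst; subst₂; module ≡-Reasoning)

∑ : ∀ {n} → (Fin n → ℕ) → ℕ
∑ {n} f = sum (map f (allFin n))

module _ {A : Set} where

  sum-map-+ : ∀ (f g : A → ℕ) xs →
              sum (map (λ x → f x + g x) xs) ≡ sum (map f xs) + sum (map g xs)
  sum-map-+ f g []       = refl
  sum-map-+ f g (x ∷ xs) = begin
    (f x + g x) + sum (map (λ x → f x + g x) xs)  ≡⟨ cong (f x + g x +_) (sum-map-+ f g xs) ⟩
    (f x + g x) + (sum (map f xs) + sum (map g xs)) ≡⟨ solve 4 (λ a b c d → (a :+ b) :+ (c :+ d) := (a :+ c) :+ (b :+ d))
                                                       refl (f x) (g x) (sum (map f xs)) (sum (map g xs)) ⟩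
    (f x + sum (map f xs)) + (g x + sum (map g xs)) ∎
    where open ≡-Reasoning
          open +-*-Solver

  sum-map-*ʳ : ∀ (f : A → ℕ) c xs → sum (map (λ x → f x * c) xs) ≡ sum (map f xs) * c
  sum-map-*ʳ f c []       = refl
  sum-map-*ʳ f c (x ∷ xs) = trans (cong (f x * c +_) (sum-map-*ʳ f c xs)) (sym (*-distribʳ-+ c (f x) _))

  sum-map-mono : ∀ {f g : A → ℕ} → (∀ x → f x ≤ g x) → ∀ xs → sum (map f xs) ≤ sum (map g xs)
  sum-map-mono f≤g []       = z≤n
  sum-map-mono f≤g (x ∷ xs) = +-mono-≤ (f≤g x) (sum-map-mono f≤g xs)

∑-suc : ∀ {n} (f : Fin (suc n) → ℕ) → ∑ f ≡ f fzero + ∑ (f ∘ fsuc)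
∑-suc f = cong (λ xs → f fzero + sum xs) (trans (map-tabulate fsuc f) (sym (map-tabulate (λ v → v) (f ∘ fsuc))))

∑-indicator : ∀ {n} (I : Subset n) c → ∑ (λ v → if lookup I v then c else 0) ≡ ∣ I ∣ * c
∑-indicator []ᵥ          c = refl
∑-indicator (true ∷ᵥ I)  c =
  trans (∑-suc (λ v → if lookup (true ∷ᵥ I) v then c else 0)) (cong (c +_) (∑-indicator I c))
∑-indicator (false ∷ᵥ I) c =
  trans (∑-suc (λ v → if lookup (false ∷ᵥ I) v then c else 0)) (∑-indicator I c)

∑-indicator-mono : ∀ {n} (I : Subset n) {a b : ℕ} {f g : Fin n → ℕ} →
                   (∀ v → (if lookup I v then a else 0) + f v ≤ (if lookup I v then b else 0) + g v) →
                   ∣ I ∣ * a + ∑ f ≤ ∣ I ∣ * b + ∑ g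
∑-indicator-mono {n} I {a} {b} {f} {g} le = begin
  ∣ I ∣ * a + ∑ f        ≡⟨ cong (_+ ∑ f) (∑-indicator I a) ⟨
  ∑ (𝟙 a) + ∑ f          ≡⟨ sum-map-+ (𝟙 a) f (allFin n) ⟨
  ∑ (λ v → 𝟙 a v + f v)  ≤⟨ sum-map-mono le (allFin n) ⟩
  ∑ (λ v → 𝟙 b v + g v)  ≡⟨ sum-map-+ (𝟙 b) g (allFin n) ⟩
  ∑ (𝟙 b) + ∑ g          ≡⟨ cong (_+ ∑ g) (∑-indicator I b) ⟩
  ∣ I ∣ * b + ∑ g        ∎
  where
  open ≤-Reasoning
  𝟙 : ℕ → Fin n → ℕ
  𝟙 c v = if lookup I v then c else 0

lookup≡false⇒∉ : ∀ {n} (I : Subset n) v → lookup I v ≡ false → v ∉ I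
lookup≡false⇒∉ I v Iv≡false v∈I with trans (sym ([]=⇒lookup v∈I)) Iv≡false
... | ()

count : {A : Set} → (A → Bool) → List A → ℕ
count f []       = 0
count f (x ∷ xs) = (if f x then 1 else 0) + count f xs

module _ {A : Set} where

  length-filter-T≡count : ∀ (f : A → Bool) xs → length (filter (T? ∘ f) xs) ≡ count f xs
  length-filter-T≡count f []       = refl
  length-filter-T≡count f (x ∷ xs) with f x
  ... | true  = cong suc (length-filter-T≡count f xs)
  ... | false = length-filter-T≡count f xs

  count-++ : ∀ (f : A → Bool) xs ys → count f (xs ++ ys) ≡ count f xs + count f ys
  count-++ f []       ys = refl
  count-++ f (x ∷ xs) ys =
    trans (cong (_ +_) (count-++ f xs ys)) (sym (+-assoc (if f x then 1 else 0) _ _))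

  count-map : ∀ {B : Set} (f : B → Bool) (g : A → B) xs → count f (map g xs) ≡ count (f ∘ g) xs
  count-map f g []       = refl
  count-map f g (x ∷ xs) = cong (_ +_) (count-map f g xs)

  count-cong : ∀ {f g : A → Bool} → (∀ x → f x ≡ g x) → ∀ xs → count f xs ≡ count g xs
  count-cong f≗g []       = refl
  count-cong f≗g (x ∷ xs) = cong₂ (λ b n → (if b then 1 else 0) + n) (f≗g x) (count-cong f≗g xs)

  count-∧ˡ : ∀ b (f : A → Bool) xs → count (λ x → b ∧ f x) xs ≡ (if b then count f xs else 0)
  count-∧ˡ true  f xs       = refl
  count-∧ˡ false f []       = refl
  count-∧ˡ false f (x ∷ xs) = count-∧ˡ false f xs

  allB-const-true : ∀ xs → allB {A} (λ _ → true) xs ≡ true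
  allB-const-true []       = refl
  allB-const-true (x ∷ xs) = allB-const-true xs

  allB-∧ : ∀ (p q : A → Bool) xs → allB (λ x → p x ∧ q x) xs ≡ allB p xs ∧ allB q xs
  allB-∧ p q []       = refl
  allB-∧ p q (x ∷ xs) rewrite allB-∧ p q xs = ∧-interchange (p x) (q x) (allB p xs) (allB q xs)

module CliqueCount {A : Set} (a : A → A → Bool) where

  #cliques : ℕ → List A → ℕ
  #cliques k L = length (filter (T? ∘ isClique a) (choose k L))

  isCliqueIn : (A → Bool) → List A → Bool
  isCliqueIn p S = allB p S ∧ isClique a S

  cliqueCount : (A → Bool) → ℕ → List A → ℕ
  cliqueCount p zero    L       = 1
  cliqueCount p (suc k) []      = 0
  cliqueCount p (suc k) (x ∷ L) =
    (if p x then cliqueCount (λ y → p y ∧ a x y) k L else 0) + cliqueCount p (suc k) L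

  Anticomplete : List A → List A → Set
  Anticomplete xs ys = All (λ x → All (λ y → a x y ≡ false) ys) xs

  isCliqueIn-∷ : ∀ p x S → isCliqueIn p (x ∷ S) ≡ p x ∧ isCliqueIn (λ y → p y ∧ a x y) S
  isCliqueIn-∷ p x S = begin
    (p x ∧ allB p S) ∧ (allB (a x) S ∧ isClique a S)  ≡⟨ ∧-assoc (p x) (allB p S) _ ⟩
    p x ∧ (allB p S ∧ (allB (a x) S ∧ isClique a S))  ≡⟨ cong (p x ∧_) (∧-assoc (allB p S) (allB (a x) S) _) ⟨
    p x ∧ ((allB p S ∧ allB (a x) S) ∧ isClique a S)  ≡⟨ cong (λ b → p x ∧ (b ∧ isClique a S)) (allB-∧ p (a x) S) ⟨
    p x ∧ isCliqueIn (λ y → p y ∧ a x y) S            ∎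
    where open ≡-Reasoning

  count-choose≡cliqueCount : ∀ p k L → count (isCliqueIn p) (choose k L) ≡ cliqueCount p k L
  count-choose≡cliqueCount p zero    L       = refl
  count-choose≡cliqueCount p (suc k) []      = refl
  count-choose≡cliqueCount p (suc k) (x ∷ L) = begin
    count (isCliqueIn p) (map (x ∷_) (choose k L) ++ choose (suc k) L)
      ≡⟨ count-++ (isCliqueIn p) (map (x ∷_) (choose k L)) _ ⟩
    count (isCliqueIn p) (map (x ∷_) (choose k L)) + count (isCliqueIn p) (choose (suc k) L)
      ≡⟨ cong₂ _+_ containingHead (count-choose≡cliqueCount p (suc k) L) ⟩
    (if p x then cliqueCount p′ k L else 0) + cliqueCount p (suc k) L
      ∎
    where
    open ≡-Reasoning
    p′ : A → Bool
    p′ y = p y ∧ a x y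
    containingHead : count (isCliqueIn p) (map (x ∷_) (choose k L)) ≡ (if p x then cliqueCount p′ k L else 0)
    containingHead = begin
      count (isCliqueIn p) (map (x ∷_) (choose k L))        ≡⟨ count-map (isCliqueIn p) (x ∷_) (choose k L) ⟩
      count (isCliqueIn p ∘ (x ∷_)) (choose k L)            ≡⟨ count-cong (isCliqueIn-∷ p x) (choose k L) ⟩
      count (λ S → p x ∧ isCliqueIn p′ S) (choose k L)      ≡⟨ count-∧ˡ (p x) (isCliqueIn p′) (choose k L) ⟩
      (if p x then count (isCliqueIn p′) (choose k L) else 0) ≡⟨ cong (λ n → if p x then n else 0)
                                                                      (count-choose≡cliqueCount p′ k L) ⟩
      (if p x then cliqueCount p′ k L else 0)               ∎

  #cliques≡cliqueCount : ∀ k L → #cliques k L ≡ cliqueCount (λ _ → true) k L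
  #cliques≡cliqueCount k L = begin
    length (filter (T? ∘ isClique a) (choose k L))  ≡⟨ length-filter-T≡count (isClique a) (choose k L) ⟩
    count (isClique a) (choose k L)                 ≡⟨ count-cong (λ S → cong (_∧ isClique a S) (allB-const-true S))
                                                                  (choose k L) ⟨
    count (isCliqueIn (λ _ → true)) (choose k L)    ≡⟨ count-choose≡cliqueCount (λ _ → true) k L ⟩
    cliqueCount (λ _ → true) k L                    ∎
    where open ≡-Reasoning

  cliqueCount-none : ∀ {p} k L → All (λ y → p y ≡ false) L → cliqueCount p (suc k) L ≡ 0
  cliqueCount-none k []      []                    = refl
  cliqueCount-none k (x ∷ L) (px≡false ∷ pL≡false) rewrite px≡false = cliqueCount-none k L pL≡false

  cliqueCount-++-none : ∀ {p} k xs {ys} → All (λ y → p y ≡ false) ys →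
                        cliqueCount p k (xs ++ ys) ≡ cliqueCount p k xs
  cliqueCount-++-none         zero    xs       _         = refl
  cliqueCount-++-none         (suc k) []       pys≡false = cliqueCount-none k _ pys≡false
  cliqueCount-++-none {p = p} (suc k) (x ∷ xs) pys≡false =
    cong₂ _+_ (cong (λ n → if p x then n else 0)
                    (cliqueCount-++-none k xs (All.map (λ {y} py≡false → cong (_∧ a x y) py≡false) pys≡false)))
              (cliqueCount-++-none (suc k) xs pys≡false)

  cliqueCount-++ : ∀ {p} k xs ys → Anticomplete xs ys →
                   cliqueCount p (suc k) (xs ++ ys) ≡ cliqueCount p (suc k) xs + cliqueCount p (suc k) ys
  cliqueCount-++         k []       ys []                = refl
  cliqueCount-++ {p = p} k (x ∷ xs) ys (x≁ys ∷ xs≁ys) =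
    trans (cong₂ _+_ (cong (λ n → if p x then n else 0) (cliqueCount-++-none k xs (All.map x≁y⇒p′≡false x≁ys)))
                     (cliqueCount-++ k xs ys xs≁ys))
          (sym (+-assoc (if p x then cliqueCount (λ y → p y ∧ a x y) k xs else 0) _ _))
    where
    x≁y⇒p′≡false : ∀ {y} → a x y ≡ false → p y ∧ a x y ≡ false
    x≁y⇒p′≡false {y} axy≡false = trans (cong (p y ∧_) axy≡false) (∧-zeroʳ (p y))

  cliqueCount-concat : ∀ {p} k xss → AllPairs Anticomplete xss →
                       cliqueCount p (suc k) (concat xss) ≡ sum (map (cliqueCount p (suc k)) xss)
  cliqueCount-concat k []         []           = refl
  cliqueCount-concat k (xs ∷ xss) (xs≁ ∷ xss≁) =
    trans (cliqueCount-++ k xs (concat xss) (All.map All.concat⁺ (All-swap xs≁)))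
          (cong (_ +_) (cliqueCount-concat k xss xss≁))

  cliqueCount-complete : ∀ {p} k L → All (λ y → p y ≡ true) L → AllPairs (λ x y → a x y ≡ true) L →
                         cliqueCount p k L ≡ length L C k
  cliqueCount-complete         zero    L       _                 _            = refl
  cliqueCount-complete         (suc k) []      _                 _            = refl
  cliqueCount-complete {p = p} (suc k) (x ∷ L) (px≡true ∷ pL≡true) (x∼L ∷ L∼) rewrite px≡true =
    trans (cong₂ _+_ (cliqueCount-complete k L (All.zipWith (λ (py , axy) → cong₂ _∧_ py axy) (pL≡true , x∼L)) L∼)
                     (cliqueCount-complete (suc k) L pL≡true L∼))
          (nCk+nC[k+1]≡[n+1]C[k+1] (length L) k)

block : ∀ {n} → (Fin n → ℕ) → Fin n → List (BVertex n)
block w v = map (v ,_) (upTo (w v))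

blowAdj-same : ∀ {n} (G : Graph n) v {i j} → ¬ i ≡ j → blowAdj G (v , i) (v , j) ≡ true
blowAdj-same G v {i} {j} i≢j with v ≟ v
... | no v≢v = ⊥-elim (v≢v refl)
... | yes _ with i ≡ᵇ j in i≡ᵇj
...   | true  = ⊥-elim (i≢j (≡ᵇ⇒≡ i j (subst T (sym i≡ᵇj) tt)))
...   | false = refl

blowAdj-distinct : ∀ {n} (G : Graph n) {u v i j} → ¬ u ≡ v → blowAdj G (u , i) (v , j) ≡ adj G u v
blowAdj-distinct G {u} {v} u≢v with u ≟ v
... | yes u≡v = ⊥-elim (u≢v u≡v)
... | no _    = refl

module _ {n} (G : Graph n) (w : Fin n → ℕ) where

  open CliqueCount (blowAdj G)

  block-complete : ∀ v → AllPairs (λ x y → blowAdj G x y ≡ true) (block w v)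
  block-complete v = AllPairs.map⁺ (AllPairs.map (blowAdj-same G v) (upTo⁺ (w v)))

  blocks-anticomplete : ∀ {I} → Independent G I → (∀ v → v ∉ I → w v ≡ 0) →
                        ∀ {u v} → ¬ u ≡ v → Anticomplete (block w u) (block w v)
  blocks-anticomplete {I} indep w-off {u} {v} u≢v with u ∈? I | v ∈? I
  ... | no u∉I | _ rewrite w-off u u∉I = []
  ... | yes _ | no v∉I rewrite w-off v v∉I = All.universal (λ _ → []) _
  ... | yes u∈I | yes v∈I =
    All.map⁺ (All.universal (λ _ → All.map⁺ (All.universal (λ _ → u≁v) _)) _)
    where
    u≁v : ∀ {i j} → blowAdj G (u , i) (v , j) ≡ false
    u≁v = trans (blowAdj-distinct G u≢v) (indep u v u∈I v∈I)

  πk-blowUp : ∀ k {I} → Independent G I → (∀ v → v ∉ I → w v ≡ 0) → πk (suc k) G w ≡ ∑ (λ v → w v C suc k)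
  πk-blowUp k indep w-off = begin
    πk (suc k) G w                                                    ≡⟨ #cliques≡cliqueCount (suc k) (blowVertices w) ⟩
    cliqueCount all (suc k) (concat (map (block w) (allFin n)))       ≡⟨ cliqueCount-concat k _ blocks-separated ⟩
    sum (map (cliqueCount all (suc k)) (map (block w) (allFin n)))    ≡⟨ cong sum (map-∘ (allFin n)) ⟨
    ∑ (λ v → cliqueCount all (suc k) (block w v))                     ≡⟨ cong sum (map-cong block-count (allFin n)) ⟩
    ∑ (λ v → w v C suc k)                                             ∎
    where
    open ≡-Reasoning
    all : BVertex n → Bool
    all _ = true
    blocks-separated : AllPairs Anticomplete (map (block w) (allFin n))
    blocks-separated = AllPairs.map⁺ (AllPairs.map (blocks-anticomplete indep w-off) (allFin⁺ n))
    block-count : ∀ v → cliqueCount all (suc k) (block w v) ≡ w v C suc k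
    block-count v = begin
      cliqueCount all (suc k) (block w v)  ≡⟨ cliqueCount-complete (suc k) (block w v) (All.universal (λ _ → refl) _)
                                                                    (block-complete v) ⟩
      length (block w v) C suc k           ≡⟨ cong (_C suc k) (trans (length-map _ (upTo (w v))) (length-upTo (w v))) ⟩
      w v C suc k                          ∎

nCk≤[1+n]Ck : ∀ n k → n C k ≤ suc n C k
nCk≤[1+n]Ck n zero    = ≤-refl
nCk≤[1+n]Ck n (suc k) = ≤-trans (m≤n+m (n C suc k) (n C k)) (≤-reflexive (nCk+nC[k+1]≡[n+1]C[k+1] n k))

nCk≤[d+n]Ck : ∀ d n k → n C k ≤ (d + n) C k
nCk≤[d+n]Ck zero    n k = ≤-refl
nCk≤[d+n]Ck (suc d) n k = ≤-trans (nCk≤[d+n]Ck d n k) (nCk≤[1+n]Ck (d + n) k)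

nC[1+k]≤n*nCk : ∀ n k → n C suc k ≤ n * (n C k)
nC[1+k]≤n*nCk zero    k = z≤n
nC[1+k]≤n*nCk (suc n) k = begin
  suc n C suc k          ≡⟨ nCk+nC[k+1]≡[n+1]C[k+1] n k ⟨
  n C k + n C suc k      ≤⟨ +-monoʳ-≤ (n C k) (nC[1+k]≤n*nCk n k) ⟩
  suc n * (n C k)        ≤⟨ *-monoʳ-≤ (suc n) (nCk≤[1+n]Ck n k) ⟩
  suc n * (suc n C k)    ∎
  where open ≤-Reasoning

C-convex-right : ∀ d q k → q C suc k + d * (q C k) ≤ (d + q) C suc k
C-convex-right zero    q k = ≤-reflexive (+-identityʳ (q C suc k))
C-convex-right (suc d) q k = begin
  q C suc k + (q C k + d * (q C k))   ≡⟨ solve 3 (λ a b c → a :+ (b :+ c) := b :+ (a :+ c)) refl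
                                                (q C suc k) (q C k) (d * (q C k)) ⟩
  q C k + (q C suc k + d * (q C k))   ≤⟨ +-mono-≤ (nCk≤[d+n]Ck d q k) (C-convex-right d q k) ⟩
  (d + q) C k + (d + q) C suc k       ≡⟨ nCk+nC[k+1]≡[n+1]C[k+1] (d + q) k ⟩
  suc (d + q) C suc k                 ∎
  where open ≤-Reasoning
        open +-*-Solver

C-convex-left : ∀ d x k → (d + x) C suc k ≤ x C suc k + d * ((d + x) C k)
C-convex-left zero    x k = ≤-reflexive (sym (+-identityʳ (x C suc k)))
C-convex-left (suc d) x k = begin
  suc (d + x) C suc k                                     ≡⟨ nCk+nC[k+1]≡[n+1]C[k+1] (d + x) k ⟨
  (d + x) C k + (d + x) C suc k                           ≤⟨ +-monoʳ-≤ ((d + x) C k) (C-convex-left d x k) ⟩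
  (d + x) C k + (x C suc k + d * ((d + x) C k))           ≤⟨ +-mono-≤ (nCk≤[1+n]Ck (d + x) k)
                                                               (+-monoʳ-≤ (x C suc k)
                                                                 (*-monoʳ-≤ d (nCk≤[1+n]Ck (d + x) k))) ⟩
  suc (d + x) C k + (x C suc k + d * (suc (d + x) C k))   ≡⟨ solve 3 (λ a b c → a :+ (b :+ c) := b :+ (a :+ c))
                                                                refl (suc (d + x) C k) (x C suc k)
                                                                (d * (suc (d + x) C k)) ⟩
  x C suc k + suc d * (suc (d + x) C k)                   ∎
  where open ≤-Reasoning
        open +-*-Solver

C-above-secant : ∀ x q k → q C suc k + x * (q C k) ≤ q * (q C k) + x C suc k
C-above-secant x q k with ≤-total q x
... | inj₁ q≤x with d , refl ← m≤n⇒∃[o]m+o≡n q≤x rewrite +-comm q d = begin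
  q C suc k + (d + q) * (q C k)              ≡⟨ solve 4 (λ a d q c → a :+ (d :+ q) :* c := q :* c :+ (a :+ d :* c)) refl
                                                     (q C suc k) d q (q C k) ⟩
  q * (q C k) + (q C suc k + d * (q C k))    ≤⟨ +-monoʳ-≤ (q * (q C k)) (C-convex-right d q k) ⟩
  q * (q C k) + (d + q) C suc k              ∎
  where open ≤-Reasoning
        open +-*-Solver
... | inj₂ x≤q with d , refl ← m≤n⇒∃[o]m+o≡n x≤q rewrite +-comm x d = begin
  (d + x) C suc k + x * ((d + x) C k)                      ≤⟨ +-monoˡ-≤ (x * ((d + x) C k)) (C-convex-left d x k) ⟩
  (x C suc k + d * ((d + x) C k)) + x * ((d + x) C k)      ≡⟨ solve 4 (λ a d x c → (a :+ d :* c) :+ x :* c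
                                                                              := (d :+ x) :* c :+ a)
                                                                 refl (x C suc k) d x ((d + x) C k) ⟩
  (d + x) * ((d + x) C k) + x C suc k                      ∎
  where open ≤-Reasoning
        open +-*-Solver

C-on-secant : ∀ x q k → x ≡ q ⊎ x ≡ suc q → q * (q C k) + x C suc k ≡ q C suc k + x * (q C k)
C-on-secant x q k (inj₁ refl) = +-comm (q * (q C k)) (q C suc k)
C-on-secant x q k (inj₂ refl) = begin
  q * (q C k) + suc q C suc k            ≡⟨ cong (q * (q C k) +_) (nCk+nC[k+1]≡[n+1]C[k+1] q k) ⟨
  q * (q C k) + (q C k + q C suc k)      ≡⟨ solve 3 (λ a b c → a :+ (b :+ c) := c :+ (b :+ a)) refl
                                                   (q * (q C k)) (q C k) (q C suc k) ⟩
  q C suc k + suc q * (q C k)            ∎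
  where open ≡-Reasoning
        open +-*-Solver

m/[1+t]≤ceilDiv : ∀ m t → m / suc t ≤ ceilDiv m t
m/[1+t]≤ceilDiv m t = /-monoˡ-≤ (suc t) (m≤m+n m t)

ceilDiv≤1+m/[1+t] : ∀ m t → ceilDiv m t ≤ suc (m / suc t)
ceilDiv≤1+m/[1+t] m t = begin
  (m + t) / suc t                 ≤⟨ /-monoˡ-≤ (suc t) (+-monoʳ-≤ m (n≤1+n t)) ⟩
  (m + suc t) / suc t             ≡⟨ +-distrib-/-∣ʳ m ∣-refl ⟩
  m / suc t + suc t / suc t       ≡⟨ cong (m / suc t +_) (n/n≡1 (suc t)) ⟩
  m / suc t + 1                   ≡⟨ +-comm (m / suc t) 1 ⟩
  suc (m / suc t)                 ∎
  where open ≤-Reasoning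

ceilDiv≡m/[1+t]⊎1+m/[1+t] : ∀ m t → ceilDiv m t ≡ m / suc t ⊎ ceilDiv m t ≡ suc (m / suc t)
ceilDiv≡m/[1+t]⊎1+m/[1+t] m t with m≤n⇒m<n∨m≡n (ceilDiv≤1+m/[1+t] m t)
... | inj₁ (s≤s ceil≤floor) = inj₁ (≤-antisym ceil≤floor (m/[1+t]≤ceilDiv m t))
... | inj₂ ceil≡1+floor     = inj₂ ceil≡1+floor

BalancedOn : ∀ {n} → ℕ → (Fin n → ℕ) → Subset n → Set
BalancedOn q w U = (∀ v → v ∉ U → w v ≡ 0) × (∀ u → u ∈ U → w u ≡ q ⊎ w u ≡ suc q)

uniformOn⇒balancedOn : ∀ {n m} {w : Fin n → ℕ} U → UniformOn m w U → Σ ℕ λ q → BalancedOn q w U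
uniformOn⇒balancedOn {m = m} U uniform with ∣ U ∣
... | zero  = ⊥-elim uniform
... | suc t = m / suc t , proj₁ uniform , λ u u∈U → rounding (proj₂ uniform u u∈U)
  where
  rounding : ∀ {x} → x ≡ m / suc t ⊎ x ≡ ceilDiv m t → x ≡ m / suc t ⊎ x ≡ suc (m / suc t)
  rounding (inj₁ x≡floor) = inj₁ x≡floor
  rounding (inj₂ refl)    = ceilDiv≡m/[1+t]⊎1+m/[1+t] m t

rearrangement : ∀ {i s c x} → i ≤ s → c ≤ x → s * c + i * x ≤ s * x + i * c
rearrangement {i} {c = c} {x} i≤s c≤x with d , refl ← m≤n⇒∃[o]m+o≡n i≤s = begin
  (i + d) * c + i * x        ≡⟨ solve 4 (λ i d c x → (i :+ d) :* c :+ i :* x := (i :* x :+ i :* c) :+ d :* c)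
                                         refl i d c x ⟩
  (i * x + i * c) + d * c    ≤⟨ +-monoʳ-≤ (i * x + i * c) (*-monoʳ-≤ d c≤x) ⟩
  (i * x + i * c) + d * x    ≡⟨ solve 4 (λ i d c x → (i :* x :+ i :* c) :+ d :* x := (i :+ d) :* x :+ i :* c)
                                         refl i d c x ⟩
  (i + d) * x + i * c        ∎
  where open ≤-Reasoning
        open +-*-Solver

module _ {n m : ℕ} (k q : ℕ) where

  ∑-*ʳ : ∀ {w : Fin n → ℕ} → IsWeighting n m w → ∀ c → ∑ (λ v → w v * c) ≡ m * c
  ∑-*ʳ {w} ∑w≡m c = trans (sum-map-*ʳ w c (allFin n)) (cong (_* c) ∑w≡m)

  secant-≤-∑C : ∀ (w : Fin n → ℕ) {I} → IsWeighting n m w → (∀ v → v ∉ I → w v ≡ 0) →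
                 ∣ I ∣ * (q C suc k) + m * (q C k) ≤ ∣ I ∣ * (q * (q C k)) + ∑ (λ v → w v C suc k)
  secant-≤-∑C w {I} ∑w≡m w-off =
    ≤-trans (≤-reflexive (cong (∣ I ∣ * (q C suc k) +_) (sym (∑-*ʳ ∑w≡m (q C k)))))
            (∑-indicator-mono I pointwise)
    where
    pointwise : ∀ v → (if lookup I v then q C suc k else 0) + w v * (q C k)
                      ≤ (if lookup I v then q * (q C k) else 0) + w v C suc k
    pointwise v with lookup I v in Iv
    ... | true  = C-above-secant (w v) q k
    ... | false rewrite w-off v (lookup≡false⇒∉ I v Iv) = z≤n

  ∑C-≤-secant : ∀ (w : Fin n → ℕ) {I} → IsWeighting n m w → BalancedOn q w I →
                 ∣ I ∣ * (q * (q C k)) + ∑ (λ v → w v C suc k) ≤ ∣ I ∣ * (q C suc k) + m * (q C k)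
  ∑C-≤-secant w {I} ∑w≡m (w-off , w-on) =
    ≤-trans (∑-indicator-mono I pointwise)
            (≤-reflexive (cong (∣ I ∣ * (q C suc k) +_) (∑-*ʳ ∑w≡m (q C k))))
    where
    pointwise : ∀ v → (if lookup I v then q * (q C k) else 0) + w v C suc k
                      ≤ (if lookup I v then q C suc k else 0) + w v * (q C k)
    pointwise v with lookup I v in Iv
    ... | true  = ≤-reflexive (C-on-secant (w v) q k (w-on v (lookup⇒[]= v I Iv)))
    ... | false rewrite w-off v (lookup≡false⇒∉ I v Iv) = z≤n

  ∑C-balanced-≤ : ∀ (w w′ : Fin n → ℕ) {I I′} → IsWeighting n m w → IsWeighting n m w′ → ∣ I ∣ ≤ ∣ I′ ∣ →
                  (∀ v → v ∉ I → w v ≡ 0) → BalancedOn q w′ I′ →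
                  ∑ (λ v → w′ v C suc k) ≤ ∑ (λ v → w v C suc k)
  ∑C-balanced-≤ w w′ {I} {I′} ∑w≡m ∑w′≡m ∣I∣≤∣I′∣ w-off balanced =
    +-cancelˡ-≤ (∣ I′ ∣ * t + ∣ I ∣ * c) S′ S (begin
    (∣ I′ ∣ * t + ∣ I ∣ * c) + S′      ≡⟨ solve 3 (λ x y z → (x :+ y) :+ z := (x :+ z) :+ y) refl
                                                  (∣ I′ ∣ * t) (∣ I ∣ * c) S′ ⟩
    (∣ I′ ∣ * t + S′) + ∣ I ∣ * c      ≤⟨ +-monoˡ-≤ (∣ I ∣ * c) (∑C-≤-secant w′ ∑w′≡m balanced) ⟩
    (∣ I′ ∣ * c + m * Δ) + ∣ I ∣ * c   ≡⟨ solve 3 (λ x y z → (x :+ y) :+ z := x :+ (z :+ y)) refl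
                                                  (∣ I′ ∣ * c) (m * Δ) (∣ I ∣ * c) ⟩
    ∣ I′ ∣ * c + (∣ I ∣ * c + m * Δ)   ≤⟨ +-monoʳ-≤ (∣ I′ ∣ * c) (secant-≤-∑C w ∑w≡m w-off) ⟩
    ∣ I′ ∣ * c + (∣ I ∣ * t + S)       ≡⟨ +-assoc (∣ I′ ∣ * c) (∣ I ∣ * t) S ⟨
    (∣ I′ ∣ * c + ∣ I ∣ * t) + S       ≤⟨ +-monoˡ-≤ S (rearrangement ∣I∣≤∣I′∣ (nC[1+k]≤n*nCk q k)) ⟩
    (∣ I′ ∣ * t + ∣ I ∣ * c) + S       ∎)
    where
    open ≤-Reasoning
    open +-*-Solver
    Δ c t S S′ : ℕ
    Δ = q C k
    c = q C suc k
    t = q * Δ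
    S = ∑ (λ v → w v C suc k)
    S′ = ∑ (λ v → w′ v C suc k)

lemma2 : (n m k : ℕ) → 1 ≤ n → 1 ≤ m → 2 ≤ k →
         (G : Graph n) → (w w′ : Fin n → ℕ) →
         IsWeighting n m w → IsWeighting n m w′ →
         (I I′ : Subset n) → Independent G I → Independent G I′ → ∣ I ∣ ≤ ∣ I′ ∣ →
         (∀ v → v ∉ I → w v ≡ 0) → UniformOn m w′ I′ →
         πk k G w′ ≤ πk k G w
lemma2 n m (suc k) _ _ (s≤s _) G w w′ ∑w≡m ∑w′≡m I I′ indep indep′ ∣I∣≤∣I′∣ w-off uniform
  with q , balanced ← uniformOn⇒balancedOn I′ uniform =
  subst₂ _≤_ (sym (πk-blowUp G w′ k indep′ (proj₁ balanced)))
             (sym (πk-blowUp G w k indep w-off))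
             (∑C-balanced-≤ k q w w′ ∑w≡m ∑w′≡m ∣I∣≤∣I′∣ w-off balanced)
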